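{- Let $n$ be a positive integer. Then $\varphi_{12}(n)$ is odd if and only if $n=2^{\alpha}$ with $\alpha\ge4$, or $n=3\cdot 2^{\alpha}$ with $\alpha\ge2$, or $n=2\cdot 3^{\beta}$ with $\beta\ge2$, or $n=4\cdot3^{\beta}$ with $\beta\ge 2$, or $n$ is of one of the following forms, where $p>3$ is a prime and $\alpha\ge1$ an integer: (1) $n=p^{\alpha}$ with $p\equiv 13,17,19$ or $23\pmod{24}$; (2) $n=2p^{\alpha}$ with $p\equiv 7,11,13$ or $17\pmod{24}$; (3) $n=3p^{\alpha}$ with $p\equiv 5$ or $7\pmod{12}$; (4) $n=4p^{\alpha}$ with $p\equiv 5$ or $7\pmod{12}$; (5) $n=6p^{\alpha}$ with $p\equiv 5$ or $7\pmod{12}$; (6) $n=12p^{\alpha}$ with $p\equiv 5$ or $11\pmod{12}$.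
   Context: For positive integers $n,e$, the generalized Euler function is $\varphi_e(n)=\#\{i\in\mathbb{Z}: 1\le i\le \lfloor n/e\rfloor,\ \gcd(i,n)=1\}$, where $\lfloor x\rfloor$ is the greatest integer not exceeding $x$. -}

module Defs where

open import Data.Nat using (ℕ; zero; suc; _+_; _*_; _^_; _/_; _%_; _≟_)
open import Data.Nat.GCD using (gcd)
open import Data.List using (List; length; filter; upTo; map)

range1 : ℕ → List ℕ
range1 m = map suc (upTo m)

φ : (e : ℕ) → .{{_ : Data.Nat.NonZero e}} → ℕ → ℕ
φ e n = length (filter (λ i → gcd i n ≟ 1) (range1 (n / e)))

-- Write n = 2^a 3^b m with m prime to 6, and let C(M, y) = #{1 ≤ i ≤ y : gcd(i, M) = 1}
-- (coprimeCount M y), so that φ₁₂(n) = C(n, ⌊n/12⌋). For a prime p ∤ M and k ≥ 1,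
-- C(p^k M, y) = C(M, y) − C(M, ⌊y/p⌋). Removing 2 and 3 this way writes C(2^a 3^b, ⌊2^a 3^b v/12⌋)
-- mod 2 as a value B_{a,b}(v) (smoothParity a b v) that depends only on v mod 24 and on a, b through
-- finitely many classes; a finite computation then shows that χ_{a,b}(v) = B_{a,b}(1) + B_{a,b}(v)
-- (character a b v) is a homomorphism (ℤ/24ℤ)^× → ℤ/2ℤ. Removing the primes p of m in turn, with v
-- running over the multiples of m prime to 6 so that ⌊v/p⌋ = v/p, gives φ₁₂(n) ≡ B_{a,b}(1) (mod 2)
-- if m = 1 and φ₁₂(n) ≡ χ_{a,b}(p) if m = p^k; once m has two distinct prime factors, every further
-- step adds a constant to itself, so φ₁₂(n) is even. The forms listed in the theorem are the table
-- of the values of B_{a,b}(1) and χ_{a,b}(p).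

module Submission where

open import Defs
open import Data.Nat using (ℕ; _*_; _^_; _%_; _≤_; _<_)
open import Data.Nat.Primality using (Prime)
open import Data.Product using (Σ; _×_; ∃-syntax)
open import Data.Sum using (_⊎_)
open import Relation.Binary.PropositionalEquality using (_≡_)
open import Function.Bundles using (_⇔_)

import Algebra.Properties.CommutativeSemigroup as CommutativeSemigroupProperties
open import Data.Bool.Base using (true; false; if_then_else_)
import Data.Bool.Properties as Bool
open import Data.Empty using (⊥-elim)
open import Data.List.Base using (List; []; _∷_; _∷ʳ_; _++_; length; filter; map; upTo)
open import Data.List.Properties using (upTo-∷ʳ; map-++; filter-++; length-++)
open import Data.List.Relation.Unary.All using (All; all?; lookup; _∷_)
open import Data.List.Membership.DecPropositional Data.Nat._≟_ using (_∈_; _∈?_)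
open import Data.List.Membership.Propositional.Properties using (∈-upTo⁺)
open import Data.Nat using (zero; suc; _+_; NonZero; >-nonZero; parity; nonTrivial⇒n>1; z<s; s≤s; z≤n; _≟_; _≤?_)
open import Data.Nat.Coprimality as Coprime using (Coprime; coprime⇒gcd≡1; gcd≡1⇒coprime; coprime-divisor)
open import Data.Nat.Divisibility
open import Data.Nat.DivMod
open import Data.Nat.GCD using (gcd; gcd[m,n]∣n)
open import Data.Nat.Induction using (<-rec)
open import Data.Nat.ListAction using (product)
open import Data.Nat.Primality
  using (prime?; prime[2]; ¬prime[0]; ¬prime[1]; prime⇒nonZero; prime⇒nonTrivial; prime⇒irreducible; euclidsLemma)
open import Data.Nat.Primality.Factorisation using (factorise)
open import Data.Nat.Properties
  using (+-comm; +-assoc; +-identityʳ; +-suc; *-comm; *-assoc; *-identityˡ; *-identityʳ; *-zeroʳ; m*n≢0; m^n≢0; m^n>0;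
         <-irrefl; <-trans; <-≤-trans; n<1+n; >⇒≢; ≤∧≢⇒<; n≢0⇒n>0; m≤n⇒m<n∨m≡n; m≤m*n; m<m*n)
import Data.Nat.Properties as ℕ
open import Data.Nat.Tactic.RingSolver using (solve-∀)
open import Data.Parity.Base as ℙ using (Parity; 0ℙ; 1ℙ)
import Data.Parity.Properties as ℙ
open import Data.Product using (_,_; proj₁; proj₂)
open import Data.Sum using (inj₁; inj₂)
open import Function.Base using (_∘_; _⟨_⟩_)
open import Function.Bundles using (mk⇔; module Equivalence)
open import Function.Construct.Composition using (_⇔-∘_)
open import Relation.Binary.PropositionalEquality using (refl; sym; trans; cong; cong₂; subst; module ≡-Reasoning)
open import Relation.Nullary using (¬_; Dec; yes; no; does; contradiction)
open import Relation.Nullary.Decidable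
  using (dec-true; dec-false; from-yes; from-no; ¬?; _×-dec_; _⊎-dec_; _→-dec_)
open ≡-Reasoning

module +-CS = CommutativeSemigroupProperties ℕ.+-commutativeSemigroup
module *-CS = CommutativeSemigroupProperties ℕ.*-commutativeSemigroup
module ℙ+-CS = CommutativeSemigroupProperties ℙ.+-commutativeSemigroup

-- Divisibility, coprimality and primes

coprime-∣ˡ : ∀ {d i M} → d ∣ i → Coprime i M → Coprime d M
coprime-∣ˡ d∣i c (e∣d , e∣M) = c (∣-trans e∣d d∣i , e∣M)

coprime-∣ʳ : ∀ {d i M} → d ∣ M → Coprime i M → Coprime i d
coprime-∣ʳ d∣M c (e∣i , e∣d) = c (e∣i , ∣-trans e∣d d∣M)

coprime-* : ∀ {i a b} → Coprime i a → Coprime i b → Coprime i (a * b)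
coprime-* ca cb (d∣i , d∣ab) = cb (d∣i , coprime-divisor (coprime-∣ˡ d∣i ca) d∣ab)

coprime-^ : ∀ {i a} k → Coprime i a → Coprime i (a ^ k)
coprime-^ zero    c (_ , d∣1) = ∣1⇒≡1 d∣1
coprime-^ (suc k) c = coprime-* c (coprime-^ k c)

prime-∤⇒coprime : ∀ {p i} → Prime p → ¬ p ∣ i → Coprime p i
prime-∤⇒coprime pp p∤i (d∣p , d∣i) with prime⇒irreducible pp d∣p
... | inj₁ d≡1 = d≡1
... | inj₂ refl = contradiction d∣i p∤i

¬coprime-common : ∀ {p i M} → Prime p → p ∣ i → p ∣ M → ¬ Coprime i M
¬coprime-common pp p∣i p∣M c = ¬prime[1] (subst Prime (c (p∣i , p∣M)) pp)

coprime-dropPrimePower : ∀ {p i M} k → Prime p → ¬ p ∣ i → Coprime i (p ^ k * M) ⇔ Coprime i M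
coprime-dropPrimePower {p} k pp p∤i =
  mk⇔ (coprime-∣ʳ (n∣m*n (p ^ k))) (coprime-* (coprime-^ k (Coprime.sym (prime-∤⇒coprime pp p∤i))))

coprime-dropPrimeFactor : ∀ {p j M} → Prime p → ¬ p ∣ M → Coprime (j * p) M ⇔ Coprime j M
coprime-dropPrimeFactor {p} pp p∤M =
  mk⇔ (coprime-∣ˡ (m∣m*n p))
      (λ c → Coprime.sym (coprime-* (Coprime.sym c) (Coprime.sym (prime-∤⇒coprime pp p∤M))))

prime[3] : Prime 3
prime[3] = from-yes (prime? 3)

prime⇒>1 : ∀ {p} → Prime p → 1 < p
prime⇒>1 {p} pp = nonTrivial⇒n>1 p {{prime⇒nonTrivial pp}}

prime⇒∤ : ∀ {p q} → Prime p → 1 < q → q < p → ¬ q ∣ p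
prime⇒∤ pp 1<q q<p q∣p with prime⇒irreducible pp q∣p
... | inj₁ refl = <-irrefl refl 1<q
... | inj₂ refl = <-irrefl refl q<p

prime-∤-^ : ∀ {p q} k → Prime p → ¬ p ∣ q → ¬ p ∣ q ^ k
prime-∤-^ zero    pp p∤q p∣1 = <-irrefl (sym (∣1⇒≡1 p∣1)) (prime⇒>1 pp)
prime-∤-^ {q = q} (suc k) pp p∤q p∣q^k+1 with euclidsLemma q (q ^ k) pp p∣q^k+1
... | inj₁ p∣q   = p∤q p∣q
... | inj₂ p∣q^k = prime-∤-^ k pp p∤q p∣q^k

primeFactor : ∀ {m} → 1 < m → ∃[ p ] (Prime p × p ∣ m)
primeFactor {m@(suc _)} 1<m with factorise m
... | record { factors = [] ; isFactorisation = m≡1 } = contradiction m≡1 (>⇒≢ 1<m)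
... | record { factors = p ∷ ps ; isFactorisation = m≡ ; factorsPrime = pp ∷ _ } =
  p , pp , subst (p ∣_) (sym m≡) (m∣m*n (product ps))

PowerSplit : ℕ → ℕ → Set
PowerSplit p m = ∃[ k ] ∃[ m′ ] (m ≡ p ^ k * m′ × ¬ p ∣ m′)

factorOut : ∀ {p} → Prime p → ∀ m → 0 < m → PowerSplit p m
factorOut {p} pp = <-rec (λ m → 0 < m → PowerSplit p m) step
  where
  step : ∀ m → (∀ {q} → q < m → 0 < q → PowerSplit p q) → 0 < m → PowerSplit p m
  step m rec 0<m with p ∣? m
  ... | no p∤m = 0 , m , sym (*-identityˡ m) , p∤m
  ... | yes p∣m@(divides q m≡qp) = extend (rec (quotient-< p∣m {{prime⇒nonTrivial pp}} {{>-nonZero 0<m}}) 0<q)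
    where
    0<q : 0 < q
    0<q = n≢0⇒n>0 λ { refl → >⇒≢ 0<m m≡qp }
    regroup : ∀ x y p → x * y * p ≡ p * x * y
    regroup = solve-∀
    extend : PowerSplit p q → PowerSplit p m
    extend (k , m′ , q≡ , p∤m′) =
      suc k , m′ , trans m≡qp (trans (cong (_* p) q≡) (regroup (p ^ k) m′ p)) , p∤m′

/-comm : ∀ m n o .{{_ : NonZero n}} .{{_ : NonZero o}} → m / n / o ≡ m / o / n
/-comm m n o = begin
  m / n / o     ≡⟨ m/n/o≡m/[n*o] m n o ⟩
  m / (n * o)   ≡⟨ /-congʳ (*-comm n o) ⟩
  m / (o * n)   ≡⟨ m/n/o≡m/[n*o] m o n ⟨
  m / o / n     ∎
  where instance
    _ = m*n≢0 n o
    _ = m*n≢0 o n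

*-/-/-cancel : ∀ d X n .{{_ : NonZero d}} .{{_ : NonZero n}} → d * X / n / d ≡ X / n
*-/-/-cancel d X n = begin
  d * X / n / d   ≡⟨ /-comm (d * X) n d ⟩
  d * X / d / n   ≡⟨ cong (_/ n) (trans (/-congˡ (*-comm d X)) (m*n/n≡m X d)) ⟩
  X / n           ∎

suc-/-cases : ∀ y p .{{_ : NonZero p}} →
              suc y ≡ suc (y / p) * p ⊎ (¬ p ∣ suc y × suc y / p ≡ y / p)
suc-/-cases y p = split (m≤n⇒m<n∨m≡n (m%n<n y p))
  where
  r = y % p
  suc-y≡ : suc y ≡ suc r + y / p * p
  suc-y≡ = cong suc (m≡m%n+[m/n]*n y p)
  split : suc r < p ⊎ suc r ≡ p → suc y ≡ suc (y / p) * p ⊎ (¬ p ∣ suc y × suc y / p ≡ y / p)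
  split (inj₂ 1+r≡p) = inj₁ (trans suc-y≡ (cong (_+ y / p * p) 1+r≡p))
  split (inj₁ 1+r<p) = inj₂ (p∤ , quotient-unchanged)
    where
    quotient-unchanged : suc y / p ≡ y / p
    quotient-unchanged = begin
      suc y / p                 ≡⟨ /-congˡ suc-y≡ ⟩
      (suc r + y / p * p) / p   ≡⟨ +-distrib-/-∣ʳ (suc r) (n∣m*n (y / p)) ⟩
      suc r / p + y / p * p / p ≡⟨ cong₂ _+_ (m<n⇒m/n≡0 1+r<p) (m*n/n≡m (y / p) p) ⟩
      y / p                     ∎
    p∤ : ¬ p ∣ suc y
    p∤ p∣ = contradiction (begin
      suc r                   ≡⟨ m<n⇒m%n≡m 1+r<p ⟨
      suc r % p               ≡⟨ [m+kn]%n≡m%n (suc r) (y / p) p ⟨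
      (suc r + y / p * p) % p ≡⟨ %-congˡ suc-y≡ ⟨
      suc y % p               ≡⟨ n∣m⇒m%n≡0 (suc y) p p∣ ⟩
      0                       ∎) λ ()

*-%-cong : ∀ {a a′ b b′} n .{{_ : NonZero n}} → a % n ≡ a′ % n → b % n ≡ b′ % n →
           a * b % n ≡ a′ * b′ % n
*-%-cong {a} {a′} {b} {b′} n a≡ b≡ = begin
  a * b % n                 ≡⟨ %-distribˡ-* a b n ⟩
  (a % n * (b % n)) % n     ≡⟨ cong₂ (λ s t → (s * t) % n) a≡ b≡ ⟩
  (a′ % n * (b′ % n)) % n   ≡⟨ %-distribˡ-* a′ b′ n ⟨
  a′ * b′ % n               ∎

0<*⇒0<ʳ : ∀ x {y} → 0 < x * y → 0 < y
0<*⇒0<ʳ x {zero}  0<x*0 = contradiction (*-zeroʳ x) (>⇒≢ 0<x*0)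
0<*⇒0<ʳ x {suc y} _     = z<s

-- Counting integers coprime to a modulus

indicator : {A : Set} → Dec A → ℕ
indicator a? = if does a? then 1 else 0

indicator-cong : {A B : Set} → (A → B) → (B → A) → (a? : Dec A) (b? : Dec B) →
                 indicator a? ≡ indicator b?
indicator-cong A→B B→A (yes a) b? rewrite dec-true b? (A→B a) = refl
indicator-cong A→B B→A (no ¬a) b? rewrite dec-false b? (¬a ∘ B→A) = refl

indicator-accept : {A : Set} → A → (a? : Dec A) → indicator a? ≡ 1
indicator-accept a a? rewrite dec-true a? a = refl

indicator-reject : {A : Set} → ¬ A → (a? : Dec A) → indicator a? ≡ 0
indicator-reject ¬a a? rewrite dec-false a? ¬a = refl

does-≡⇒⇔ : {A B : Set} (a? : Dec A) (b? : Dec B) → does a? ≡ does b? → A ⇔ B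
does-≡⇒⇔ (yes a) (yes b) _ = mk⇔ (λ _ → b) (λ _ → a)
does-≡⇒⇔ (no ¬a) (no ¬b) _ = mk⇔ (⊥-elim ∘ ¬a) (⊥-elim ∘ ¬b)

length-filter-∷ʳ : {A : Set} {P : A → Set} (P? : ∀ x → Dec (P x)) (xs : List A) (x : A) →
                   length (filter P? (xs ∷ʳ x)) ≡ length (filter P? xs) + indicator (P? x)
length-filter-∷ʳ P? xs x = begin
  length (filter P? (xs ∷ʳ x))                       ≡⟨ cong length (filter-++ P? xs (x ∷ [])) ⟩
  length (filter P? xs ++ filter P? (x ∷ []))        ≡⟨ length-++ (filter P? xs) ⟩
  length (filter P? xs) + length (filter P? (x ∷ [])) ≡⟨ cong (length (filter P? xs) +_) singleton ⟩
  length (filter P? xs) + indicator (P? x)           ∎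
  where
  singleton : length (filter P? (x ∷ [])) ≡ indicator (P? x)
  singleton with does (P? x)
  ... | true  = refl
  ... | false = refl

range1-suc : ∀ y → range1 (suc y) ≡ range1 y ∷ʳ suc y
range1-suc y = trans (cong (map suc) (sym (upTo-∷ʳ y))) (map-++ suc (upTo y) (y ∷ []))

coprimeCount : ℕ → ℕ → ℕ
coprimeCount M y = length (filter (λ i → gcd i M ≟ 1) (range1 y))

φ≡coprimeCount : ∀ e n .{{_ : NonZero e}} → φ e n ≡ coprimeCount n (n / e)
φ≡coprimeCount e n = refl

coprimeCount-suc : ∀ M y → coprimeCount M (suc y) ≡ coprimeCount M y + indicator (gcd (suc y) M ≟ 1)
coprimeCount-suc M y = trans (cong (length ∘ filter (λ i → gcd i M ≟ 1)) (range1-suc y))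
                             (length-filter-∷ʳ (λ i → gcd i M ≟ 1) (range1 y) (suc y))

coprimeIndicator-cong : ∀ {i M j N} → Coprime i M ⇔ Coprime j N →
                        indicator (gcd i M ≟ 1) ≡ indicator (gcd j N ≟ 1)
coprimeIndicator-cong {i} {M} {j} {N} i⇔j =
  indicator-cong (coprime⇒gcd≡1 ∘ to ∘ gcd≡1⇒coprime) (coprime⇒gcd≡1 ∘ from ∘ gcd≡1⇒coprime)
                 (gcd i M ≟ 1) (gcd j N ≟ 1)
  where open Equivalence i⇔j

coprimeIndicator-reject : ∀ {i M} → ¬ Coprime i M → indicator (gcd i M ≟ 1) ≡ 0
coprimeIndicator-reject {i} {M} ¬c = indicator-reject (¬c ∘ gcd≡1⇒coprime) (gcd i M ≟ 1)

coprimeCount-1 : ∀ y → coprimeCount 1 y ≡ y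
coprimeCount-1 zero    = refl
coprimeCount-1 (suc y) = begin
  coprimeCount 1 (suc y)
    ≡⟨ coprimeCount-suc 1 y ⟩
  coprimeCount 1 y + indicator (gcd (suc y) 1 ≟ 1)
    ≡⟨ cong₂ _+_ (coprimeCount-1 y) (indicator-accept (∣1⇒≡1 (gcd[m,n]∣n (suc y) 1)) (gcd (suc y) 1 ≟ 1)) ⟩
  y + 1
    ≡⟨ +-comm y 1 ⟩
  suc y ∎

coprimeCount-removePrimePower : ∀ {p M} k .{{_ : NonZero p}} → Prime p → ¬ p ∣ M → ∀ y →
  coprimeCount (p ^ suc k * M) y + coprimeCount M (y / p) ≡ coprimeCount M y
coprimeCount-removePrimePower {p} {M} k pp p∤M = go
  where
  N = p ^ suc k * M
  p∣N : p ∣ N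
  p∣N = ∣m⇒∣m*n M (m∣m*n (p ^ k))
  δ : ℕ → ℕ → ℕ
  δ L i = indicator (gcd i L ≟ 1)
  go : ∀ y → coprimeCount N y + coprimeCount M (y / p) ≡ coprimeCount M y
  go zero = cong (coprimeCount M) (0/n≡0 p)
  go (suc y) with suc-/-cases y p
  ... | inj₁ suc-y≡ = begin
    coprimeCount N (suc y) + coprimeCount M (suc y / p)
      ≡⟨ cong₂ _+_ (coprimeCount-suc N y) (cong (coprimeCount M) (trans (/-congˡ suc-y≡) (m*n/n≡m _ p))) ⟩
    coprimeCount N y + δ N (suc y) + coprimeCount M (suc (y / p))
      ≡⟨ cong₂ (λ a b → coprimeCount N y + a + b)
           (coprimeIndicator-reject {suc y} {N} (¬coprime-common pp (divides (suc (y / p)) suc-y≡) p∣N))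
           (coprimeCount-suc M (y / p)) ⟩
    coprimeCount N y + 0 + (coprimeCount M (y / p) + δ M (suc (y / p)))
      ≡⟨ cong (_+ (coprimeCount M (y / p) + δ M (suc (y / p)))) (+-identityʳ (coprimeCount N y)) ⟩
    coprimeCount N y + (coprimeCount M (y / p) + δ M (suc (y / p)))
      ≡⟨ +-assoc (coprimeCount N y) (coprimeCount M (y / p)) (δ M (suc (y / p))) ⟨
    coprimeCount N y + coprimeCount M (y / p) + δ M (suc (y / p))
      ≡⟨ cong₂ _+_ (go y) (sym (trans (cong (δ M) suc-y≡)
           (coprimeIndicator-cong {suc (y / p) * p} {M} {suc (y / p)} {M} (coprime-dropPrimeFactor pp p∤M)))) ⟩
    coprimeCount M y + δ M (suc y)
      ≡⟨ coprimeCount-suc M y ⟨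
    coprimeCount M (suc y) ∎
  ... | inj₂ (p∤ , quotient-unchanged) = begin
    coprimeCount N (suc y) + coprimeCount M (suc y / p)
      ≡⟨ cong₂ _+_ (coprimeCount-suc N y) (cong (coprimeCount M) quotient-unchanged) ⟩
    coprimeCount N y + δ N (suc y) + coprimeCount M (y / p)
      ≡⟨ cong (λ a → coprimeCount N y + a + coprimeCount M (y / p))
              (coprimeIndicator-cong {suc y} {N} {suc y} {M} (coprime-dropPrimePower (suc k) pp p∤)) ⟩
    coprimeCount N y + δ M (suc y) + coprimeCount M (y / p)
      ≡⟨ +-CS.xy∙z≈xz∙y (coprimeCount N y) (δ M (suc y)) (coprimeCount M (y / p)) ⟩
    coprimeCount N y + coprimeCount M (y / p) + δ M (suc y)
      ≡⟨ cong (_+ δ M (suc y)) (go y) ⟩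
    coprimeCount M y + δ M (suc y)
      ≡⟨ coprimeCount-suc M y ⟨
    coprimeCount M (suc y) ∎

parity-%2 : ∀ n → parity (n % 2) ≡ parity n
parity-%2 zero          = refl
parity-%2 (suc zero)    = refl
parity-%2 (suc (suc n)) = parity-%2 n

%2≡1⇔parity≡1ℙ : ∀ n → (n % 2 ≡ 1) ⇔ (parity n ≡ 1ℙ)
%2≡1⇔parity≡1ℙ zero          = mk⇔ (λ ()) (λ ())
%2≡1⇔parity≡1ℙ (suc zero)    = mk⇔ (λ _ → refl) (λ _ → refl)
%2≡1⇔parity≡1ℙ (suc (suc n)) = %2≡1⇔parity≡1ℙ n

x+y+y≡x : ∀ x y → x ℙ.+ y ℙ.+ y ≡ x
x+y+y≡x x y = begin
  x ℙ.+ y ℙ.+ y       ≡⟨ ℙ.+-assoc x y y ⟩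
  x ℙ.+ (y ℙ.+ y)     ≡⟨ cong (x ℙ.+_) (ℙ.p+p≡0ℙ y) ⟩
  x ℙ.+ 0ℙ            ≡⟨ ℙ.+-identityʳ x ⟩
  x                   ∎

parity-+-cancelʳ : ∀ a b {c} → a + b ≡ c → parity a ≡ parity c ℙ.+ parity b
parity-+-cancelʳ a b refl =
  trans (sym (x+y+y≡x (parity a) (parity b))) (cong (ℙ._+ parity b) (sym (ℙ.+-homo-+ a b)))

parity-coprimeCount-removePrimePower : ∀ {p M} k .{{_ : NonZero p}} → Prime p → ¬ p ∣ M → ∀ y →
  parity (coprimeCount (p ^ suc k * M) y) ≡ parity (coprimeCount M y) ℙ.+ parity (coprimeCount M (y / p))
parity-coprimeCount-removePrimePower {p} {M} k pp p∤M y =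
  parity-+-cancelʳ (coprimeCount (p ^ suc k * M) y) (coprimeCount M (y / p))
                   (coprimeCount-removePrimePower k pp p∤M y)

-- The contribution of the exponents of 2 and 3

smooth : ℕ → ℕ → ℕ
smooth a b = 2 ^ a * 3 ^ b

-- Reducing mod 2 before taking the parity lets closed instances be evaluated with builtin arithmetic.
floorParity : ℕ → ℕ → ℕ → Parity
floorParity x z v = parity (smooth x z * v / 12 % 2)

layer : ℕ → (ℕ → Parity) → Parity
layer zero    f = f zero
layer (suc a) f = f (suc a) ℙ.+ f a

smoothParity : ℕ → ℕ → ℕ → Parity
smoothParity a b v = layer a (λ x → layer b (λ z → floorParity x z v))

smooth-/2 : ∀ x z v → smooth (suc x) z * v / 12 / 2 ≡ smooth x z * v / 12
smooth-/2 x z v = trans (cong (λ t → t / 12 / 2) (regroup (2 ^ x) (3 ^ z) v)) (*-/-/-cancel 2 (smooth x z * v) 12)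
  where
  regroup : ∀ s t v → 2 * s * t * v ≡ 2 * (s * t * v)
  regroup = solve-∀

smooth-/3 : ∀ x z v → smooth x (suc z) * v / 12 / 3 ≡ smooth x z * v / 12
smooth-/3 x z v = trans (cong (λ t → t / 12 / 3) (regroup (2 ^ x) (3 ^ z) v)) (*-/-/-cancel 3 (smooth x z * v) 12)
  where
  regroup : ∀ s t v → s * (3 * t) * v ≡ 3 * (s * t * v)
  regroup = solve-∀

parity-coprimeCount-3^ : ∀ b x v →
  parity (coprimeCount (3 ^ b) (smooth x b * v / 12)) ≡ layer b (λ z → floorParity x z v)
parity-coprimeCount-3^ zero x v = trans (cong parity (coprimeCount-1 Y)) (sym (parity-%2 Y))
  where Y = smooth x 0 * v / 12
parity-coprimeCount-3^ (suc b) x v = begin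
  parity (coprimeCount (3 ^ suc b) Y)
    ≡⟨ cong (λ M → parity (coprimeCount M Y)) (*-identityʳ (3 ^ suc b)) ⟨
  parity (coprimeCount (3 ^ suc b * 1) Y)
    ≡⟨ parity-coprimeCount-removePrimePower b prime[3] (from-no (3 ∣? 1)) Y ⟩
  parity (coprimeCount 1 Y) ℙ.+ parity (coprimeCount 1 (Y / 3))
    ≡⟨ cong₂ (λ s t → parity s ℙ.+ parity t) (coprimeCount-1 Y)
             (trans (coprimeCount-1 (Y / 3)) (smooth-/3 x b v)) ⟩
  parity Y ℙ.+ parity (smooth x b * v / 12)
    ≡⟨ cong₂ ℙ._+_ (parity-%2 Y) (parity-%2 (smooth x b * v / 12)) ⟨
  floorParity x (suc b) v ℙ.+ floorParity x b v ∎
  where Y = smooth x (suc b) * v / 12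

parity-coprimeCount-smooth : ∀ a b v →
  parity (coprimeCount (smooth a b) (smooth a b * v / 12)) ≡ smoothParity a b v
parity-coprimeCount-smooth zero b v = trans (cong (λ M → parity (coprimeCount M Y)) (*-identityˡ (3 ^ b)))
                                            (parity-coprimeCount-3^ b 0 v)
  where Y = smooth 0 b * v / 12
parity-coprimeCount-smooth (suc a) b v = begin
  parity (coprimeCount (2 ^ suc a * 3 ^ b) Y)
    ≡⟨ parity-coprimeCount-removePrimePower a prime[2] (prime-∤-^ b prime[2] (from-no (2 ∣? 3))) Y ⟩
  parity (coprimeCount (3 ^ b) Y) ℙ.+ parity (coprimeCount (3 ^ b) (Y / 2))
    ≡⟨ cong (λ t → parity (coprimeCount (3 ^ b) Y) ℙ.+ parity (coprimeCount (3 ^ b) t)) (smooth-/2 a b v) ⟩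
  parity (coprimeCount (3 ^ b) Y) ℙ.+ parity (coprimeCount (3 ^ b) (smooth a b * v / 12))
    ≡⟨ cong₂ ℙ._+_ (parity-coprimeCount-3^ b (suc a) v) (parity-coprimeCount-3^ b a v) ⟩
  smoothParity (suc a) b v ∎
  where Y = smooth (suc a) b * v / 12

-- Periodicity and the finite verification

floorParity-cong : ∀ {x x′ z z′ v v′} → 2 ^ x % 24 ≡ 2 ^ x′ % 24 → 3 ^ z % 24 ≡ 3 ^ z′ % 24 →
                   v % 24 ≡ v′ % 24 → floorParity x z v ≡ floorParity x′ z′ v′
floorParity-cong {x} {x′} {z} {z′} {v} {v′} 2^x≡ 3^z≡ v≡ = begin
  parity (smooth x z * v / 12 % 2)      ≡⟨ cong parity (m%[n*o]/o≡m/o%n (smooth x z * v) 2 12) ⟨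
  parity (smooth x z * v % 24 / 12)     ≡⟨ cong (λ r → parity (r / 12)) smooth*v≡ ⟩
  parity (smooth x′ z′ * v′ % 24 / 12)  ≡⟨ cong parity (m%[n*o]/o≡m/o%n (smooth x′ z′ * v′) 2 12) ⟩
  parity (smooth x′ z′ * v′ / 12 % 2)   ∎
  where
  smooth*v≡ : smooth x z * v % 24 ≡ smooth x′ z′ * v′ % 24
  smooth*v≡ = *-%-cong {smooth x z} {smooth x′ z′} {v} {v′} 24
                (*-%-cong {2 ^ x} {2 ^ x′} {3 ^ z} {3 ^ z′} 24 2^x≡ 3^z≡) v≡

2^-period : ∀ x → 2 ^ (5 + x) % 24 ≡ 2 ^ (3 + x) % 24
2^-period x = trans (cong (_% 24) (32s≡8s+24s (2 ^ x))) ([m+kn]%n≡m%n (2 ^ (3 + x)) (2 ^ x) 24)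
  where
  32s≡8s+24s : ∀ s → 2 * (2 * (2 * (2 * (2 * s)))) ≡ 2 * (2 * (2 * s)) + s * 24
  32s≡8s+24s = solve-∀

3^-period : ∀ z → 3 ^ (3 + z) % 24 ≡ 3 ^ (1 + z) % 24
3^-period z = trans (cong (_% 24) (27s≡3s+24s (3 ^ z))) ([m+kn]%n≡m%n (3 ^ (1 + z)) (3 ^ z) 24)
  where
  27s≡3s+24s : ∀ s → 3 * (3 * (3 * s)) ≡ 3 * s + s * 24
  27s≡3s+24s = solve-∀

layer-cong : ∀ {f g} a → (∀ x → f x ≡ g x) → layer a f ≡ layer a g
layer-cong zero    f≗g = f≗g zero
layer-cong (suc a) f≗g = cong₂ ℙ._+_ (f≗g (suc a)) (f≗g a)

layer-periodic : ∀ {f} c → (∀ x → f (2 + (c + x)) ≡ f (c + x)) →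
                 ∀ a → layer (2 + (suc c + a)) f ≡ layer (suc c + a) f
layer-periodic {f} c per a =
  cong₂ ℙ._+_ (subst (λ t → f (2 + t) ≡ f t) (+-suc c a) (per (suc a))) (per a)

smoothParity-mod24 : ∀ a b v → smoothParity a b v ≡ smoothParity a b (v % 24)
smoothParity-mod24 a b v = layer-cong a λ x → layer-cong b λ z →
  floorParity-cong {x} {x} {z} {z} refl refl (sym (m%n%n≡m%n v 24))

smoothParity-period₂ : ∀ a b v → smoothParity (6 + a) b v ≡ smoothParity (4 + a) b v
smoothParity-period₂ a b v =
  layer-periodic {λ x → layer b (λ z → floorParity x z v)} 3
                 (λ x → layer-cong b λ z → floorParity-cong {5 + x} {3 + x} {z} {z} {v} (2^-period x) refl refl) a

smoothParity-period₃ : ∀ a b v → smoothParity a (4 + b) v ≡ smoothParity a (2 + b) v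
smoothParity-period₃ a b v = layer-cong a λ x →
  layer-periodic {λ z → floorParity x z v} 1
                 (λ z → floorParity-cong {x} {x} {3 + z} {1 + z} {v} refl (3^-period z) refl) b

-- 2 ^ x mod 24 has period 2 from x = 3 on, and smoothParity a involves the exponents a and a ∸ 1;
-- 3 ^ z mod 24 has period 2 from z = 1 on.
reduceExp2 : ℕ → ℕ
reduceExp2 (suc (suc (suc (suc (suc (suc a)))))) = reduceExp2 (suc (suc (suc (suc a))))
reduceExp2 a = a

reduceExp3 : ℕ → ℕ
reduceExp3 (suc (suc (suc (suc b)))) = reduceExp3 (suc (suc b))
reduceExp3 b = b

reduceExp2<6 : ∀ a → reduceExp2 a < 6
reduceExp2<6 (suc (suc (suc (suc (suc (suc a)))))) = reduceExp2<6 (suc (suc (suc (suc a))))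
reduceExp2<6 0 = s≤s z≤n
reduceExp2<6 1 = s≤s (s≤s z≤n)
reduceExp2<6 2 = s≤s (s≤s (s≤s z≤n))
reduceExp2<6 3 = s≤s (s≤s (s≤s (s≤s z≤n)))
reduceExp2<6 4 = s≤s (s≤s (s≤s (s≤s (s≤s z≤n))))
reduceExp2<6 5 = s≤s (s≤s (s≤s (s≤s (s≤s (s≤s z≤n)))))

reduceExp3<4 : ∀ b → reduceExp3 b < 4
reduceExp3<4 (suc (suc (suc (suc b)))) = reduceExp3<4 (suc (suc b))
reduceExp3<4 0 = s≤s z≤n
reduceExp3<4 1 = s≤s (s≤s z≤n)
reduceExp3<4 2 = s≤s (s≤s (s≤s z≤n))
reduceExp3<4 3 = s≤s (s≤s (s≤s (s≤s z≤n)))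

reduceExp2∈ : ∀ a → reduceExp2 a ∈ upTo 6
reduceExp2∈ a = ∈-upTo⁺ (reduceExp2<6 a)

reduceExp3∈ : ∀ b → reduceExp3 b ∈ upTo 4
reduceExp3∈ b = ∈-upTo⁺ (reduceExp3<4 b)

reduceExp2-invariant : {A : Set} (f : ℕ → A) → (∀ a → f (6 + a) ≡ f (4 + a)) →
                       ∀ a → f (reduceExp2 a) ≡ f a
reduceExp2-invariant f per (suc (suc (suc (suc (suc (suc a)))))) =
  trans (reduceExp2-invariant f per (suc (suc (suc (suc a))))) (sym (per a))
reduceExp2-invariant f per 0 = refl
reduceExp2-invariant f per 1 = refl
reduceExp2-invariant f per 2 = refl
reduceExp2-invariant f per 3 = refl
reduceExp2-invariant f per 4 = refl
reduceExp2-invariant f per 5 = refl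

reduceExp3-invariant : {A : Set} (f : ℕ → A) → (∀ b → f (4 + b) ≡ f (2 + b)) →
                       ∀ b → f (reduceExp3 b) ≡ f b
reduceExp3-invariant f per (suc (suc (suc (suc b)))) =
  trans (reduceExp3-invariant f per (suc (suc b))) (sym (per b))
reduceExp3-invariant f per 0 = refl
reduceExp3-invariant f per 1 = refl
reduceExp3-invariant f per 2 = refl
reduceExp3-invariant f per 3 = refl

smoothParity-reduce : ∀ a b v → smoothParity a b v ≡ smoothParity (reduceExp2 a) (reduceExp3 b) (v % 24)
smoothParity-reduce a b v = begin
  smoothParity a b v                       ≡⟨ smoothParity-mod24 a b v ⟩
  smoothParity a b v′                      ≡⟨ reduceExp2-invariant (λ a → smoothParity a b v′)
                                                (λ a → smoothParity-period₂ a b v′) a ⟨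
  smoothParity (reduceExp2 a) b v′          ≡⟨ reduceExp3-invariant (λ b → smoothParity (reduceExp2 a) b v′)
                                                (λ b → smoothParity-period₃ (reduceExp2 a) b v′) b ⟨
  smoothParity (reduceExp2 a) (reduceExp3 b) v′ ∎
  where v′ = v % 24

character : ℕ → ℕ → ℕ → Parity
character a b c = smoothParity a b 1 ℙ.+ smoothParity a b c

character-reduce : ∀ a b c → character a b c ≡ character (reduceExp2 a) (reduceExp3 b) (c % 24)
character-reduce a b c = cong₂ ℙ._+_ (smoothParity-reduce a b 1) (smoothParity-reduce a b c)

OddSmoothPart : ℕ → ℕ → Set
OddSmoothPart a b = (4 ≤ a × b ≡ 0) ⊎ (2 ≤ a × b ≡ 1) ⊎ (a ≡ 1 × 2 ≤ b) ⊎ (a ≡ 2 × 2 ≤ b)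

oddSmoothPart? : ∀ a b → Dec (OddSmoothPart a b)
oddSmoothPart? a b =
  (4 ≤? a ×-dec b ≟ 0) ⊎-dec (2 ≤? a ×-dec b ≟ 1) ⊎-dec (a ≟ 1 ×-dec 2 ≤? b) ⊎-dec (a ≟ 2 ×-dec 2 ≤? b)

ResidueClass : ℕ → ℕ → ℕ → ℕ → Set
ResidueClass a b r₂₄ r₁₂ =
    (a ≡ 0 × b ≡ 0 × (r₂₄ ≡ 13 ⊎ r₂₄ ≡ 17 ⊎ r₂₄ ≡ 19 ⊎ r₂₄ ≡ 23))
  ⊎ (a ≡ 1 × b ≡ 0 × (r₂₄ ≡ 7 ⊎ r₂₄ ≡ 11 ⊎ r₂₄ ≡ 13 ⊎ r₂₄ ≡ 17))
  ⊎ (a ≡ 0 × b ≡ 1 × (r₁₂ ≡ 5 ⊎ r₁₂ ≡ 7))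
  ⊎ (a ≡ 2 × b ≡ 0 × (r₁₂ ≡ 5 ⊎ r₁₂ ≡ 7))
  ⊎ (a ≡ 1 × b ≡ 1 × (r₁₂ ≡ 5 ⊎ r₁₂ ≡ 7))
  ⊎ (a ≡ 2 × b ≡ 1 × (r₁₂ ≡ 5 ⊎ r₁₂ ≡ 11))

OddResidue : ℕ → ℕ → ℕ → Set
OddResidue a b p = ResidueClass a b (p % 24) (p % 12)

residueClass? : ∀ a b r₂₄ r₁₂ → Dec (ResidueClass a b r₂₄ r₁₂)
residueClass? a b r s =
      (a ≟ 0 ×-dec b ≟ 0 ×-dec (r ≟ 13 ⊎-dec r ≟ 17 ⊎-dec r ≟ 19 ⊎-dec r ≟ 23))
  ⊎-dec (a ≟ 1 ×-dec b ≟ 0 ×-dec (r ≟ 7 ⊎-dec r ≟ 11 ⊎-dec r ≟ 13 ⊎-dec r ≟ 17))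
  ⊎-dec (a ≟ 0 ×-dec b ≟ 1 ×-dec (s ≟ 5 ⊎-dec s ≟ 7))
  ⊎-dec (a ≟ 2 ×-dec b ≟ 0 ×-dec (s ≟ 5 ⊎-dec s ≟ 7))
  ⊎-dec (a ≟ 1 ×-dec b ≟ 1 ×-dec (s ≟ 5 ⊎-dec s ≟ 7))
  ⊎-dec (a ≟ 2 ×-dec b ≟ 1 ×-dec (s ≟ 5 ⊎-dec s ≟ 11))

oddResidue? : ∀ a b p → Dec (OddResidue a b p)
oddResidue? a b p = residueClass? a b (p % 24) (p % 12)

CoprimeTo6 : ℕ → Set
CoprimeTo6 v = ¬ 2 ∣ v × ¬ 3 ∣ v

units24 : List ℕ
units24 = 1 ∷ 5 ∷ 7 ∷ 11 ∷ 13 ∷ 17 ∷ 19 ∷ 23 ∷ []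

residue-table : All (λ r → ¬ 2 ∣ r → ¬ 3 ∣ r → r ∈ units24) (upTo 24)
residue-table = from-yes (all? (λ r → ¬? (2 ∣? r) →-dec ¬? (3 ∣? r) →-dec r ∈? units24) (upTo 24))

character-table : All (λ a → All (λ b → All (λ c → All (λ u →
                    character a b (c * u % 24) ≡ character a b c ℙ.+ character a b u)
                  units24) units24) (upTo 4)) (upTo 6)
character-table = from-yes (all? (λ a → all? (λ b → all? (λ c → all? (λ u →
                    character a b (c * u % 24) ℙ.≟ character a b c ℙ.+ character a b u)
                    units24) units24) (upTo 4)) (upTo 6))

oddSmoothPart-table : All (λ a → All (λ b →
                        does (smoothParity a b 1 ℙ.≟ 1ℙ) ≡ does (oddSmoothPart? a b)) (upTo 4)) (upTo 6)
oddSmoothPart-table = from-yes (all? (λ a → all? (λ b →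
                        does (smoothParity a b 1 ℙ.≟ 1ℙ) Bool.≟ does (oddSmoothPart? a b)) (upTo 4)) (upTo 6))

oddResidue-table : All (λ a → All (λ b → All (λ r →
                     does (character a b r ℙ.≟ 1ℙ) ≡ does (oddResidue? a b r)) units24) (upTo 4)) (upTo 6)
oddResidue-table = from-yes (all? (λ a → all? (λ b → all? (λ r →
                     does (character a b r ℙ.≟ 1ℙ) Bool.≟ does (oddResidue? a b r)) units24) (upTo 4)) (upTo 6))

mod24∈units24 : ∀ {v} → CoprimeTo6 v → v % 24 ∈ units24
mod24∈units24 {v} (2∤v , 3∤v) =
  lookup residue-table (∈-upTo⁺ (m%n<n v 24)) (2∤v ∘ ∣n∣m%n⇒∣m (divides 12 refl)) (3∤v ∘ ∣n∣m%n⇒∣m (divides 8 refl))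

character-* : ∀ a b {c u} → CoprimeTo6 c → CoprimeTo6 u →
              character a b (c * u) ≡ character a b c ℙ.+ character a b u
character-* a b {c} {u} c6 u6 = begin
  character a b (c * u)                  ≡⟨ character-reduce a b (c * u) ⟩
  character A B (c * u % 24)             ≡⟨ cong (character A B) (%-distribˡ-* c u 24) ⟩
  character A B (c % 24 * (u % 24) % 24) ≡⟨ lookup (lookup (lookup (lookup character-table (reduceExp2∈ a))
                                              (reduceExp3∈ b)) (mod24∈units24 c6)) (mod24∈units24 u6) ⟩
  character A B (c % 24) ℙ.+ character A B (u % 24)
    ≡⟨ cong₂ ℙ._+_ (character-reduce a b c) (character-reduce a b u) ⟨
  character a b c ℙ.+ character a b u    ∎
  where
  A = reduceExp2 a
  B = reduceExp3 b

smoothParity-odd⇔ : ∀ a b → (smoothParity a b 1 ≡ 1ℙ) ⇔ OddSmoothPart a b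
smoothParity-odd⇔ a b = does-≡⇒⇔ (smoothParity a b 1 ℙ.≟ 1ℙ) (oddSmoothPart? a b) (begin
  does (smoothParity a b 1 ℙ.≟ 1ℙ)    ≡⟨ cong (λ t → does (t ℙ.≟ 1ℙ)) (smoothParity-reduce a b 1) ⟩
  does (smoothParity A B 1 ℙ.≟ 1ℙ)    ≡⟨ lookup (lookup oddSmoothPart-table (reduceExp2∈ a)) (reduceExp3∈ b) ⟩
  does (oddSmoothPart? A B)           ≡⟨ reduceExp2-invariant (λ a → does (oddSmoothPart? a B)) (λ _ → refl) a ⟩
  does (oddSmoothPart? a B)           ≡⟨ reduceExp3-invariant (λ b → does (oddSmoothPart? a b)) (λ _ → refl) b ⟩
  does (oddSmoothPart? a b)           ∎)
  where
  A = reduceExp2 a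
  B = reduceExp3 b

character-odd⇔ : ∀ a b {p} → CoprimeTo6 p → (character a b p ≡ 1ℙ) ⇔ OddResidue a b p
character-odd⇔ a b {p} p6 = does-≡⇒⇔ (character a b p ℙ.≟ 1ℙ) (oddResidue? a b p) (begin
  does (character a b p ℙ.≟ 1ℙ)       ≡⟨ cong (λ t → does (t ℙ.≟ 1ℙ)) (character-reduce a b p) ⟩
  does (character A B r ℙ.≟ 1ℙ)       ≡⟨ lookup (lookup (lookup oddResidue-table (reduceExp2∈ a)) (reduceExp3∈ b))
                                              (mod24∈units24 p6) ⟩
  does (oddResidue? A B r)            ≡⟨ reduceExp2-invariant (λ a → does (oddResidue? a B r)) (λ _ → refl) a ⟩
  does (oddResidue? a B r)            ≡⟨ reduceExp3-invariant (λ b → does (oddResidue? a b r)) (λ _ → refl) b ⟩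
  does (oddResidue? a b r)            ≡⟨ cong₂ (λ s t → does (residueClass? a b s t)) (m%n%n≡m%n p 24)
                                              (m∣n⇒o%n%m≡o%m 12 24 p (divides 2 refl)) ⟩
  does (oddResidue? a b p)            ∎)
  where
  A = reduceExp2 a
  B = reduceExp3 b
  r = p % 24

-- Peeling off the primes larger than 3

countParity : ℕ → ℕ → ℕ → ℕ → Parity
countParity a b m v = parity (coprimeCount (smooth a b * m) (smooth a b * v / 12))

countParity-1 : ∀ a b v → countParity a b 1 v ≡ smoothParity a b v
countParity-1 a b v = trans (cong (λ M → parity (coprimeCount M (smooth a b * v / 12))) (*-identityʳ (smooth a b)))
                            (parity-coprimeCount-smooth a b v)

countParity-peel : ∀ a b {p m v} k .{{_ : NonZero p}} → Prime p → ¬ p ∣ smooth a b * m → p ∣ v →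
  countParity a b (p ^ suc k * m) v ≡ countParity a b m v ℙ.+ countParity a b m (v / p)
countParity-peel a b {p} {m} {v} k pp p∤ p∣v = begin
  parity (coprimeCount (W * (p ^ suc k * m)) (W * v / 12))
    ≡⟨ cong (λ M → parity (coprimeCount M (W * v / 12))) (*-CS.x∙yz≈y∙xz W (p ^ suc k) m) ⟩
  parity (coprimeCount (p ^ suc k * (W * m)) (W * v / 12))
    ≡⟨ parity-coprimeCount-removePrimePower k pp p∤ (W * v / 12) ⟩
  countParity a b m v ℙ.+ parity (coprimeCount (W * m) (W * v / 12 / p))
    ≡⟨ cong (λ y → countParity a b m v ℙ.+ parity (coprimeCount (W * m) y))
            (trans (/-comm (W * v) 12 p) (cong (_/ 12) (*-/-assoc W p∣v))) ⟩
  countParity a b m v ℙ.+ countParity a b m (v / p) ∎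
  where W = smooth a b

prime>3⇒coprimeTo6 : ∀ {p} → Prime p → 3 < p → CoprimeTo6 p
prime>3⇒coprimeTo6 pp 3<p =
  prime⇒∤ pp (s≤s (s≤s z≤n)) (<-trans (n<1+n 2) 3<p) , prime⇒∤ pp (s≤s (s≤s z≤n)) 3<p

prime>3⇒∤smooth : ∀ {p} a b → Prime p → 3 < p → ¬ p ∣ smooth a b
prime>3⇒∤smooth a b pp 3<p p∣ with euclidsLemma (2 ^ a) (3 ^ b) pp p∣
... | inj₁ p∣2^a = prime-∤-^ a pp (>⇒∤ (<-trans (n<1+n 2) 3<p)) p∣2^a
... | inj₂ p∣3^b = prime-∤-^ b pp (>⇒∤ 3<p) p∣3^b

coprimeTo6-∣ : ∀ {d v} → d ∣ v → CoprimeTo6 v → CoprimeTo6 d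
coprimeTo6-∣ d∣v (2∤v , 3∤v) = 2∤v ∘ (_⟨ ∣-trans ⟩ d∣v) , 3∤v ∘ (_⟨ ∣-trans ⟩ d∣v)

character-+ : ∀ a b x y → character a b x ℙ.+ character a b y ≡ smoothParity a b x ℙ.+ smoothParity a b y
character-+ a b x y = trans (ℙ+-CS.interchange s (smoothParity a b x) s (smoothParity a b y))
                            (cong (ℙ._+ (smoothParity a b x ℙ.+ smoothParity a b y)) (ℙ.p+p≡0ℙ s))
  where s = smoothParity a b 1

countParity-primePower : ∀ a b {p v} k → Prime p → 3 < p → CoprimeTo6 v → p ^ suc k ∣ v →
                         countParity a b (p ^ suc k) v ≡ character a b p
countParity-primePower a b {p} {v} k pp 3<p v6 pᵏ⁺¹∣v = begin
  countParity a b (p ^ suc k) v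
    ≡⟨ cong (λ m → countParity a b m v) (*-identityʳ (p ^ suc k)) ⟨
  countParity a b (p ^ suc k * 1) v
    ≡⟨ countParity-peel a b k pp p∤W p∣v ⟩
  countParity a b 1 v ℙ.+ countParity a b 1 u
    ≡⟨ cong₂ ℙ._+_ (countParity-1 a b v) (countParity-1 a b u) ⟩
  smoothParity a b v ℙ.+ smoothParity a b u
    ≡⟨ cong (λ t → smoothParity a b t ℙ.+ smoothParity a b u) (m*[n/m]≡n p∣v) ⟨
  smoothParity a b (p * u) ℙ.+ smoothParity a b u
    ≡⟨ character-+ a b (p * u) u ⟨
  character a b (p * u) ℙ.+ character a b u
    ≡⟨ cong (ℙ._+ character a b u) (character-* a b p6 u6) ⟩
  character a b p ℙ.+ character a b u ℙ.+ character a b u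
    ≡⟨ x+y+y≡x (character a b p) (character a b u) ⟩
  character a b p ∎
  where
  instance _ = prime⇒nonZero pp
  u = v / p
  p∣v : p ∣ v
  p∣v = ∣-trans (m∣m*n (p ^ k)) pᵏ⁺¹∣v
  p6 = prime>3⇒coprimeTo6 pp 3<p
  u6 = coprimeTo6-∣ (m/n∣m p∣v) v6
  p∤W : ¬ p ∣ smooth a b * 1
  p∤W = prime>3⇒∤smooth a b pp 3<p ∘ subst (p ∣_) (*-identityʳ (smooth a b))

countParity-peelConstant : ∀ a b {p k m c} → Prime p → 3 < p → ¬ p ∣ m →
  (∀ x → m ∣ x → CoprimeTo6 x → countParity a b m x ≡ c) →
  ∀ v → p ^ suc k * m ∣ v → CoprimeTo6 v → countParity a b (p ^ suc k * m) v ≡ 0ℙ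
countParity-peelConstant a b {p} {k} {m} {c} pp 3<p p∤m constant v pᵏ⁺¹m∣v v6 = begin
  countParity a b (p ^ suc k * m) v                   ≡⟨ countParity-peel a b k pp p∤Wm p∣v ⟩
  countParity a b m v ℙ.+ countParity a b m (v / p)   ≡⟨ cong₂ ℙ._+_ (constant v m∣v v6)
                                                            (constant (v / p) m∣v/p v/p6) ⟩
  c ℙ.+ c                                             ≡⟨ ℙ.p+p≡0ℙ c ⟩
  0ℙ                                                  ∎
  where
  instance _ = prime⇒nonZero pp
  p∣v : p ∣ v
  p∣v = ∣-trans (∣m⇒∣m*n m (m∣m*n (p ^ k))) pᵏ⁺¹m∣v
  m∣v : m ∣ v
  m∣v = ∣-trans (n∣m*n (p ^ suc k)) pᵏ⁺¹m∣v
  v/p6 : CoprimeTo6 (v / p)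
  v/p6 = coprimeTo6-∣ (m/n∣m p∣v) v6
  m∣v/p : m ∣ v / p
  m∣v/p = ∣-trans (n∣m*n (p ^ k))
                  (m*n∣o⇒n∣o/m p (p ^ k * m) (subst (_∣ v) (*-assoc p (p ^ k) m) pᵏ⁺¹m∣v))
  p∤Wm : ¬ p ∣ smooth a b * m
  p∤Wm p∣Wm with euclidsLemma (smooth a b) m pp p∣Wm
  ... | inj₁ p∣W = prime>3⇒∤smooth a b pp 3<p p∣W
  ... | inj₂ p∣m = p∤m p∣m

prime∣coprimeTo6⇒>3 : ∀ {p m} → Prime p → p ∣ m → CoprimeTo6 m → 3 < p
prime∣coprimeTo6⇒>3 {0} pp _ _ = contradiction pp ¬prime[0]
prime∣coprimeTo6⇒>3 {1} pp _ _ = contradiction pp ¬prime[1]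
prime∣coprimeTo6⇒>3 {2} _ 2∣m (2∤m , _) = contradiction 2∣m 2∤m
prime∣coprimeTo6⇒>3 {3} _ 3∣m (_ , 3∤m) = contradiction 3∣m 3∤m
prime∣coprimeTo6⇒>3 {suc (suc (suc (suc _)))} _ _ _ = s≤s (s≤s (s≤s (s≤s z≤n)))

splitPrimePower : ∀ {m} → 1 < m → CoprimeTo6 m →
  ∃[ p ] ∃[ k ] ∃[ m′ ] (Prime p × 3 < p × m ≡ p ^ suc k * m′ × ¬ p ∣ m′)
splitPrimePower {m} 1<m m6 with primeFactor 1<m
... | p , pp , p∣m with factorOut pp m (<-trans z<s 1<m)
...   | zero  , m′ , m≡ , p∤m′ = contradiction (subst (p ∣_) (trans m≡ (*-identityˡ m′)) p∣m) p∤m′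
...   | suc k , m′ , m≡ , p∤m′ = p , k , m′ , pp , prime∣coprimeTo6⇒>3 pp p∣m m6 , m≡ , p∤m′

Vanishes : ℕ → Set
Vanishes m = ∀ a b v → m ∣ v → CoprimeTo6 v → countParity a b m v ≡ 0ℙ

data Classification (m : ℕ) : Set where
  unit       : m ≡ 1 → Classification m
  primePower : ∀ {p} k → Prime p → 3 < p → m ≡ p ^ suc k → Classification m
  vanishing  : Vanishes m → Classification m

classify : ∀ m → 0 < m → CoprimeTo6 m → Classification m
classify = <-rec (λ m → 0 < m → CoprimeTo6 m → Classification m) step
  where
  step : ∀ m → (∀ {m′} → m′ < m → 0 < m′ → CoprimeTo6 m′ → Classification m′) →
         0 < m → CoprimeTo6 m → Classification m
  step m rec 0<m m6 with m ≟ 1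
  ... | yes m≡1 = unit m≡1
  ... | no m≢1 with splitPrimePower (≤∧≢⇒< 0<m (m≢1 ∘ sym)) m6
  ...   | p , k , m′ , pp , 3<p , m≡ , p∤m′ =
    subst Classification (sym m≡) (extend (rec m′<m 0<m′ (coprimeTo6-∣ m′∣m m6)))
    where
    m′∣m : m′ ∣ m
    m′∣m = divides (p ^ suc k) m≡
    0<m′ : 0 < m′
    0<m′ = n≢0⇒n>0 λ { refl → >⇒≢ 0<m (trans m≡ (*-zeroʳ (p ^ suc k))) }
    m′<m : m′ < m
    m′<m = subst (m′ <_) (trans (*-comm m′ (p ^ suc k)) (sym m≡))
                 (m<m*n m′ (p ^ suc k) {{>-nonZero 0<m′}} (<-≤-trans (prime⇒>1 pp) (m≤m*n p (p ^ k))))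
      where instance _ = prime⇒nonZero pp
                     _ = m^n≢0 p k
    extend : Classification m′ → Classification (p ^ suc k * m′)
    extend (unit m′≡1) = primePower k pp 3<p (trans (cong (p ^ suc k *_) m′≡1) (*-identityʳ (p ^ suc k)))
    extend (primePower j qq 3<q m′≡) = vanishing λ a b →
      countParity-peelConstant a b {k = k} pp 3<p p∤m′ λ x m′∣x x6 →
        trans (cong (λ t → countParity a b t x) m′≡)
              (countParity-primePower a b j qq 3<q x6 (subst (_∣ x) m′≡ m′∣x))
    extend (vanishing f) = vanishing λ a b → countParity-peelConstant a b {k = k} pp 3<p p∤m′ (f a b)

-- The odd cases

OddCases : ℕ → ℕ → ℕ → Set
OddCases a b m = (m ≡ 1 × OddSmoothPart a b)
               ⊎ ∃[ p ] ∃[ k ] (Prime p × 3 < p × m ≡ p ^ suc k × OddResidue a b p)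

φ12-odd⇔ : ∀ a b m → 0 < m → CoprimeTo6 m → (φ 12 (smooth a b * m) % 2 ≡ 1) ⇔ OddCases a b m
φ12-odd⇔ a b m 0<m m6 = subst (λ c → (c % 2 ≡ 1) ⇔ OddCases a b m) (sym (φ≡coprimeCount 12 (smooth a b * m)))
                              (mk⇔ to from ⇔-∘ %2≡1⇔parity≡1ℙ (coprimeCount (smooth a b * m) (smooth a b * m / 12)))
  where
  oddAt : ∀ {s t} → s ≡ t → countParity a b s s ≡ 1ℙ → countParity a b t t ≡ 1ℙ
  oddAt = subst (λ t → countParity a b t t ≡ 1ℙ)
  to : countParity a b m m ≡ 1ℙ → OddCases a b m
  to odd with classify m 0<m m6
  ... | unit m≡1 =
    inj₁ (m≡1 , Equivalence.to (smoothParity-odd⇔ a b) (trans (sym (countParity-1 a b 1)) (oddAt m≡1 odd)))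
  ... | primePower k pp 3<p m≡ =
    inj₂ (_ , k , pp , 3<p , m≡ , Equivalence.to (character-odd⇔ a b (prime>3⇒coprimeTo6 pp 3<p))
      (trans (sym (countParity-primePower a b k pp 3<p (subst CoprimeTo6 m≡ m6) ∣-refl)) (oddAt m≡ odd)))
  ... | vanishing f = contradiction (trans (sym (f a b m ∣-refl m6)) odd) λ ()
  from : OddCases a b m → countParity a b m m ≡ 1ℙ
  from (inj₁ (m≡1 , odd)) =
    oddAt (sym m≡1) (trans (countParity-1 a b 1) (Equivalence.from (smoothParity-odd⇔ a b) odd))
  from (inj₂ (p , k , pp , 3<p , m≡ , odd)) =
    oddAt (sym m≡) (trans (countParity-primePower a b k pp 3<p (subst CoprimeTo6 m≡ m6) ∣-refl)
                          (Equivalence.from (character-odd⇔ a b (prime>3⇒coprimeTo6 pp 3<p)) odd))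

smoothDecomposition : ∀ n → 0 < n → ∃[ a ] ∃[ b ] ∃[ m ] (n ≡ smooth a b * m × 0 < m × CoprimeTo6 m)
smoothDecomposition n 0<n with factorOut prime[2] n 0<n
... | a , n′ , n≡ , 2∤n′ with factorOut prime[3] n′ (0<*⇒0<ʳ (2 ^ a) (subst (0 <_) n≡ 0<n))
...   | b , m , n′≡ , 3∤m =
  a , b , m , trans n≡ (trans (cong (2 ^ a *_) n′≡) (sym (*-assoc (2 ^ a) (3 ^ b) m))) ,
  0<*⇒0<ʳ (3 ^ b) (subst (0 <_) n′≡ (0<*⇒0<ʳ (2 ^ a) (subst (0 <_) n≡ 0<n))) ,
  2∤n′ ∘ (_⟨ ∣-trans ⟩ divides (3 ^ b) n′≡) , 3∤m

OddForms : ℕ → Set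
OddForms n =
  (∃[ a ] (4 ≤ a × n ≡ 2 ^ a))
  ⊎ (∃[ a ] (2 ≤ a × n ≡ 3 * 2 ^ a))
  ⊎ (∃[ b ] (2 ≤ b × n ≡ 2 * 3 ^ b))
  ⊎ (∃[ b ] (2 ≤ b × n ≡ 4 * 3 ^ b))
  ⊎ (∃[ p ] ∃[ a ] (Prime p × 3 < p × 1 ≤ a × n ≡ p ^ a
       × (p % 24 ≡ 13 ⊎ p % 24 ≡ 17 ⊎ p % 24 ≡ 19 ⊎ p % 24 ≡ 23)))
  ⊎ (∃[ p ] ∃[ a ] (Prime p × 3 < p × 1 ≤ a × n ≡ 2 * p ^ a
       × (p % 24 ≡ 7 ⊎ p % 24 ≡ 11 ⊎ p % 24 ≡ 13 ⊎ p % 24 ≡ 17)))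
  ⊎ (∃[ p ] ∃[ a ] (Prime p × 3 < p × 1 ≤ a × n ≡ 3 * p ^ a
       × (p % 12 ≡ 5 ⊎ p % 12 ≡ 7)))
  ⊎ (∃[ p ] ∃[ a ] (Prime p × 3 < p × 1 ≤ a × n ≡ 4 * p ^ a
       × (p % 12 ≡ 5 ⊎ p % 12 ≡ 7)))
  ⊎ (∃[ p ] ∃[ a ] (Prime p × 3 < p × 1 ≤ a × n ≡ 6 * p ^ a
       × (p % 12 ≡ 5 ⊎ p % 12 ≡ 7)))
  ⊎ (∃[ p ] ∃[ a ] (Prime p × 3 < p × 1 ≤ a × n ≡ 12 * p ^ a
       × (p % 12 ≡ 5 ⊎ p % 12 ≡ 11)))

oddCases⇒oddForms : ∀ {a b m} → OddCases a b m → OddForms (smooth a b * m)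
oddCases⇒oddForms {a} (inj₁ (refl , inj₁ (4≤a , refl))) =
  inj₁ (a , 4≤a , trans (*-identityʳ (2 ^ a * 1)) (*-identityʳ (2 ^ a)))
oddCases⇒oddForms {a} (inj₁ (refl , inj₂ (inj₁ (2≤a , refl)))) =
  inj₂ (inj₁ (a , 2≤a , trans (*-identityʳ (2 ^ a * 3)) (*-comm (2 ^ a) 3)))
oddCases⇒oddForms {b = b} (inj₁ (refl , inj₂ (inj₂ (inj₁ (refl , 2≤b))))) =
  inj₂ (inj₂ (inj₁ (b , 2≤b , *-identityʳ (2 * 3 ^ b))))
oddCases⇒oddForms {b = b} (inj₁ (refl , inj₂ (inj₂ (inj₂ (refl , 2≤b))))) =
  inj₂ (inj₂ (inj₂ (inj₁ (b , 2≤b , *-identityʳ (4 * 3 ^ b)))))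
oddCases⇒oddForms (inj₂ (p , k , pp , 3<p , refl , residue)) = primeForm residue
  where
  primeForm : ∀ {a b} → OddResidue a b p → OddForms (smooth a b * p ^ suc k)
  primeForm (inj₁ (refl , refl , r)) =
    inj₂ (inj₂ (inj₂ (inj₂ (inj₁ (p , suc k , pp , 3<p , s≤s z≤n , *-identityˡ (p ^ suc k) , r)))))
  primeForm (inj₂ (inj₁ (refl , refl , r))) =
    inj₂ (inj₂ (inj₂ (inj₂ (inj₂ (inj₁ (p , suc k , pp , 3<p , s≤s z≤n , refl , r))))))
  primeForm (inj₂ (inj₂ (inj₁ (refl , refl , r)))) =
    inj₂ (inj₂ (inj₂ (inj₂ (inj₂ (inj₂ (inj₁ (p , suc k , pp , 3<p , s≤s z≤n , refl , r)))))))
  primeForm (inj₂ (inj₂ (inj₂ (inj₁ (refl , refl , r))))) =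
    inj₂ (inj₂ (inj₂ (inj₂ (inj₂ (inj₂ (inj₂ (inj₁ (p , suc k , pp , 3<p , s≤s z≤n , refl , r))))))))
  primeForm (inj₂ (inj₂ (inj₂ (inj₂ (inj₁ (refl , refl , r)))))) =
    inj₂ (inj₂ (inj₂ (inj₂ (inj₂ (inj₂ (inj₂ (inj₂ (inj₁ (p , suc k , pp , 3<p , s≤s z≤n , refl , r)))))))))
  primeForm (inj₂ (inj₂ (inj₂ (inj₂ (inj₂ (refl , refl , r)))))) =
    inj₂ (inj₂ (inj₂ (inj₂ (inj₂ (inj₂ (inj₂ (inj₂ (inj₂ (p , suc k , pp , 3<p , s≤s z≤n , refl , r)))))))))

smoothCase : ∀ {a b} → OddSmoothPart a b → 0 < 1 × CoprimeTo6 1 × OddCases a b 1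
smoothCase odd = z<s , (from-no (2 ∣? 1) , from-no (3 ∣? 1)) , inj₁ (refl , odd)

primePowerCase : ∀ {a b p e} → 1 ≤ e → Prime p → 3 < p → OddResidue a b p →
                 0 < p ^ e × CoprimeTo6 (p ^ e) × OddCases a b (p ^ e)
primePowerCase {p = p} {e = suc k} _ pp 3<p odd =
  m^n>0 p (suc k) , (prime-∤-^ (suc k) prime[2] 2∤p , prime-∤-^ (suc k) prime[3] 3∤p) ,
  inj₂ (p , k , pp , 3<p , refl , odd)
  where
  instance _ = prime⇒nonZero pp
  2∤p = proj₁ (prime>3⇒coprimeTo6 pp 3<p)
  3∤p = proj₂ (prime>3⇒coprimeTo6 pp 3<p)

oddForms⇒oddCases : ∀ {n} → OddForms n →
  ∃[ a ] ∃[ b ] ∃[ m ] (n ≡ smooth a b * m × 0 < m × CoprimeTo6 m × OddCases a b m)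
oddForms⇒oddCases (inj₁ (a , 4≤a , refl)) =
  a , 0 , 1 , sym (trans (*-identityʳ (2 ^ a * 1)) (*-identityʳ (2 ^ a))) , smoothCase (inj₁ (4≤a , refl))
oddForms⇒oddCases (inj₂ (inj₁ (a , 2≤a , refl))) =
  a , 1 , 1 , sym (trans (*-identityʳ (2 ^ a * 3)) (*-comm (2 ^ a) 3)) , smoothCase (inj₂ (inj₁ (2≤a , refl)))
oddForms⇒oddCases (inj₂ (inj₂ (inj₁ (b , 2≤b , refl)))) =
  1 , b , 1 , sym (*-identityʳ (2 * 3 ^ b)) , smoothCase (inj₂ (inj₂ (inj₁ (refl , 2≤b))))
oddForms⇒oddCases (inj₂ (inj₂ (inj₂ (inj₁ (b , 2≤b , refl))))) =
  2 , b , 1 , sym (*-identityʳ (4 * 3 ^ b)) , smoothCase (inj₂ (inj₂ (inj₂ (refl , 2≤b))))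
oddForms⇒oddCases (inj₂ (inj₂ (inj₂ (inj₂ (inj₁ (p , e , pp , 3<p , 1≤e , refl , r)))))) =
  0 , 0 , p ^ e , sym (*-identityˡ (p ^ e)) , primePowerCase 1≤e pp 3<p (inj₁ (refl , refl , r))
oddForms⇒oddCases (inj₂ (inj₂ (inj₂ (inj₂ (inj₂ (inj₁ (p , e , pp , 3<p , 1≤e , refl , r))))))) =
  1 , 0 , p ^ e , refl , primePowerCase 1≤e pp 3<p (inj₂ (inj₁ (refl , refl , r)))
oddForms⇒oddCases (inj₂ (inj₂ (inj₂ (inj₂ (inj₂ (inj₂ (inj₁ (p , e , pp , 3<p , 1≤e , refl , r)))))))) =
  0 , 1 , p ^ e , refl , primePowerCase 1≤e pp 3<p (inj₂ (inj₂ (inj₁ (refl , refl , r))))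
oddForms⇒oddCases (inj₂ (inj₂ (inj₂ (inj₂ (inj₂ (inj₂ (inj₂ (inj₁ (p , e , pp , 3<p , 1≤e , refl , r))))))))) =
  2 , 0 , p ^ e , refl , primePowerCase 1≤e pp 3<p (inj₂ (inj₂ (inj₂ (inj₁ (refl , refl , r)))))
oddForms⇒oddCases (inj₂ (inj₂ (inj₂ (inj₂ (inj₂ (inj₂ (inj₂ (inj₂ (inj₁ (p , e , pp , 3<p , 1≤e , refl , r)))))))))) =
  1 , 1 , p ^ e , refl , primePowerCase 1≤e pp 3<p (inj₂ (inj₂ (inj₂ (inj₂ (inj₁ (refl , refl , r))))))
oddForms⇒oddCases (inj₂ (inj₂ (inj₂ (inj₂ (inj₂ (inj₂ (inj₂ (inj₂ (inj₂ (p , e , pp , 3<p , 1≤e , refl , r)))))))))) =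
  2 , 1 , p ^ e , refl , primePowerCase 1≤e pp 3<p (inj₂ (inj₂ (inj₂ (inj₂ (inj₂ (refl , refl , r))))))

theorem5p2 : (n : ℕ) → 1 ≤ n →
    (φ 12 n % 2 ≡ 1) ⇔
    ((∃[ a ] (4 ≤ a × n ≡ 2 ^ a))
     ⊎ (∃[ a ] (2 ≤ a × n ≡ 3 * 2 ^ a))
     ⊎ (∃[ b ] (2 ≤ b × n ≡ 2 * 3 ^ b))
     ⊎ (∃[ b ] (2 ≤ b × n ≡ 4 * 3 ^ b))
     ⊎ (∃[ p ] ∃[ a ] (Prime p × 3 < p × 1 ≤ a × n ≡ p ^ a
          × (p % 24 ≡ 13 ⊎ p % 24 ≡ 17 ⊎ p % 24 ≡ 19 ⊎ p % 24 ≡ 23)))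
     ⊎ (∃[ p ] ∃[ a ] (Prime p × 3 < p × 1 ≤ a × n ≡ 2 * p ^ a
          × (p % 24 ≡ 7 ⊎ p % 24 ≡ 11 ⊎ p % 24 ≡ 13 ⊎ p % 24 ≡ 17)))
     ⊎ (∃[ p ] ∃[ a ] (Prime p × 3 < p × 1 ≤ a × n ≡ 3 * p ^ a
          × (p % 12 ≡ 5 ⊎ p % 12 ≡ 7)))
     ⊎ (∃[ p ] ∃[ a ] (Prime p × 3 < p × 1 ≤ a × n ≡ 4 * p ^ a
          × (p % 12 ≡ 5 ⊎ p % 12 ≡ 7)))
     ⊎ (∃[ p ] ∃[ a ] (Prime p × 3 < p × 1 ≤ a × n ≡ 6 * p ^ a
          × (p % 12 ≡ 5 ⊎ p % 12 ≡ 7)))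
     ⊎ (∃[ p ] ∃[ a ] (Prime p × 3 < p × 1 ≤ a × n ≡ 12 * p ^ a
          × (p % 12 ≡ 5 ⊎ p % 12 ≡ 11))))
theorem5p2 n 1≤n = mk⇔ forward backward
  where
  forward : φ 12 n % 2 ≡ 1 → OddForms n
  forward odd with smoothDecomposition n 1≤n
  ... | a , b , m , n≡ , 0<m , m6 =
    subst OddForms (sym n≡) (oddCases⇒oddForms
      (Equivalence.to (φ12-odd⇔ a b m 0<m m6) (subst (λ t → φ 12 t % 2 ≡ 1) n≡ odd)))
  backward : OddForms n → φ 12 n % 2 ≡ 1
  backward forms with oddForms⇒oddCases forms
  ... | a , b , m , n≡ , 0<m , m6 , cases =
    subst (λ t → φ 12 t % 2 ≡ 1) (sym n≡) (Equivalence.from (φ12-odd⇔ a b m 0<m m6) cases)
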